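{- Let $n$ be a prime, let $k \in \mathbb{N}$ and let $X, Y \subseteq \mathbb{Z}_n$ satisfy $|X| = |Y| = k$ and $|X \hat{+} X| = |Y \hat{+} Y| = \binom{k}{2}$. If $Y \ne X$ and $(X \hat{+} X) \cap (Y \hat{+} Y) \ne \emptyset$, then $$\big|(X \hat{+} X) \cap (Y \hat{+} Y)\big| \le \frac{k(k - t)}{2},$$ where $t = \min\{|Y'| : Y' \in \mathcal{I}^*(X, Y)\}$, with $\mathcal{I}(X, Y) = \{Y' \subseteq Y : (X \hat{+} X) \cap (Y' \hat{+} Y') = \emptyset\}$ and $\mathcal{I}^*(X, Y) = \{Y' \in \mathcal{I}(X, Y) : (y + Y') \cap (X \hat{+} X) \ne \emptyset \text{ for all } y \in Y \setminus Y'\}$.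
   Context: $X \hat{+} X = \{x_1 + x_2 : x_1, x_2 \in X, x_1 \ne x_2\}$ and $y + Y' = \{y + y' : y' \in Y'\}$. -}

module Defs where

open import Data.Nat using (ℕ; zero; suc; _+_)
open import Data.Nat.DivMod using (_mod_)
open import Data.Fin using (Fin; toℕ; _≟_)
open import Data.Fin.Properties using (any?)
open import Data.Fin.Subset using (Subset; _∈_; _∉_; _∩_; _⊆_; _─_; Nonempty; Empty; ∣_∣)
open import Data.Fin.Subset.Properties using (_∈?_)
open import Data.Product using (_×_; ∃; _,_)
open import Data.Vec using (tabulate)
open import Relation.Nullary using (¬_; Dec; yes; no)
open import Relation.Nullary.Decidable using (⌊_⌋; _×-dec_; ¬?)
open import Relation.Binary.PropositionalEquality using (_≡_)

_⊕_ : {n : ℕ} → Fin n → Fin n → Fin n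
_⊕_ {suc m} x y = (toℕ x + toℕ y) mod suc m

_+̂_ : {n : ℕ} → Subset n → Subset n → Subset n
_+̂_ {n} X X' = tabulate λ z → ⌊ any? (λ x₁ → any? (λ x₂ →
      (x₁ ∈? X) ×-dec ((x₂ ∈? X') ×-dec (¬? (x₁ ≟ x₂) ×-dec ((x₁ ⊕ x₂) ≟ z))))) ⌋

hatSum : {n : ℕ} → Subset n → Subset n
hatSum X = X +̂ X

translate : {n : ℕ} → Fin n → Subset n → Subset n
translate y Y' = tabulate λ z → ⌊ any? (λ y' → (y' ∈? Y') ×-dec ((y ⊕ y') ≟ z)) ⌋

InI : {n : ℕ} → Subset n → Subset n → Subset n → Set
InI X Y Y' = (Y' ⊆ Y) × Empty (hatSum X ∩ hatSum Y')

InIStar : {n : ℕ} → Subset n → Subset n → Subset n → Set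
InIStar X Y Y' = InI X Y Y' ×
  (∀ y → y ∈ (Y ─ Y') → ¬ Empty (translate y Y' ∩ hatSum X))

IsMinIStarSize : {n : ℕ} → Subset n → Subset n → ℕ → Set
IsMinIStarSize X Y t =
  (∃ λ Y' → InIStar X Y Y' × ∣ Y' ∣ ≡ t) ×
  (∀ Y' → InIStar X Y Y' → t Data.Nat.≤ ∣ Y' ∣)

-- Join two elements y ≠ y' of Y by an edge when y + y' ∈ X +̂ X.  Every
-- s ∈ (X +̂ X) ∩ (Y +̂ Y) is the sum of the endpoints of an edge, which is
-- counted once from each endpoint, so 2 |(X +̂ X) ∩ (Y +̂ Y)| is at most the
-- sum of the degrees.  For y ∈ Y, extend {y} greedily to a maximal Y' ∈ 𝓘;
-- maximality puts Y' in 𝓘*, so |Y'| ≥ t, and no neighbour of y lies in Y',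
-- so deg y ≤ |Y| - |Y'| ≤ k - t.
module Submission where

open import Defs
open import Data.Nat using (ℕ; zero; suc; _+_; _*_; _∸_; _≤_; z≤n)
open import Data.Nat.Properties
  using (+-comm; +-identityʳ; *-identityʳ; +-mono-≤; +-monoʳ-≤; m≤m+n; m≤n+m; ≤-reflexive; ≤-trans;
         ∸-monoʳ-≤; m+n≤o⇒m≤o∸n; module ≤-Reasoning)
import Data.Nat.Properties as ℕ
open import Data.Nat.DivMod using (_mod_)
open import Data.Nat.Primality using (Prime)
open import Data.Nat.Combinatorics using (_C_)
open import Algebra.Properties.Semiring.Sum ℕ.+-*-semiring
  using (sum; sum-syntax; sum-cong-≗; sum-replicate-zero; ∑-distrib-+; ∑-comm; *-distribˡ-sum)
open import Data.Bool using (if_then_else_)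
open import Data.Fin using (Fin; zero; suc; toℕ; _≟_)
open import Data.Fin.Properties using (any?)
open import Data.Fin.Subset
  using (Subset; inside; outside; _∈_; _∉_; _∩_; _∪_; _─_; _⊆_; _⊂_; _⊃_; ⁅_⁆; Empty; ∣_∣)
open import Data.Fin.Subset.Properties
  using (_∈?_; nonempty?; drop-there; x∈p∩q⁺; x∈p∩q⁻; x∈p∪q⁺; x∈p∪q⁻; x∈⁅x⁆; x∈⁅y⁆⇒x≡y; p⊆p∪q; p─q⊆p)
open import Data.Fin.Subset.Induction using (Acc; acc; ⊃-wellFounded)
open import Data.Vec using (_∷_; []; tabulate; here; there)
open import Data.Vec.Properties using (lookup∘tabulate; []=⇒lookup; lookup⇒[]=)
open import Data.Product using (∃; ∃₂; _×_; _,_; proj₁; proj₂)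
open import Data.Sum using (_⊎_; inj₁; inj₂)
import Data.Sum as Sum
open import Data.Empty using (⊥-elim)
open import Function using (_∘_)
open import Level using (0ℓ)
open import Relation.Nullary using (¬_; Dec; yes; no; does)
open import Relation.Nullary.Decidable using (⌊_⌋; _×-dec_; ¬?; dec-true; dec-false)
open import Relation.Unary using (Pred; Decidable)
open import Relation.Binary.PropositionalEquality
  using (_≡_; _≢_; refl; sym; trans; cong; cong₂; subst; module ≡-Reasoning)

private
  variable
    n : ℕ

𝟙 : {P : Set} → Dec P → ℕ
𝟙 P? = if does P? then 1 else 0

𝟙-yes : {P : Set} (P? : Dec P) → P → 𝟙 P? ≡ 1
𝟙-yes P? p rewrite dec-true P? p = refl

𝟙-no : {P : Set} (P? : Dec P) → ¬ P → 𝟙 P? ≡ 0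
𝟙-no P? ¬p rewrite dec-false P? ¬p = refl

𝟙-×-dec : {P Q : Set} (P? : Dec P) (Q? : Dec Q) → 𝟙 (P? ×-dec Q?) ≡ 𝟙 P? * 𝟙 Q?
𝟙-×-dec (yes _) Q? = sym (+-identityʳ (𝟙 Q?))
𝟙-×-dec (no _)  Q? = refl

𝟙-disjoint : {P Q R : Set} (P? : Dec P) (Q? : Dec Q) (R? : Dec R) →
  (P → R) → (Q → R) → (P → ¬ Q) → 𝟙 P? + 𝟙 Q? ≤ 𝟙 R?
𝟙-disjoint (yes p) (yes q) R? P⇒R Q⇒R P⇒¬Q = ⊥-elim (P⇒¬Q p q)
𝟙-disjoint (yes p) (no _)  R? P⇒R Q⇒R P⇒¬Q = ≤-reflexive (sym (𝟙-yes R? (P⇒R p)))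
𝟙-disjoint (no _)  (yes q) R? P⇒R Q⇒R P⇒¬Q = ≤-reflexive (sym (𝟙-yes R? (Q⇒R q)))
𝟙-disjoint (no _)  (no _)  R? P⇒R Q⇒R P⇒¬Q = z≤n

∑-mono-≤ : {f g : Fin n → ℕ} → (∀ i → f i ≤ g i) → sum f ≤ sum g
∑-mono-≤ {zero}  f≤g = z≤n
∑-mono-≤ {suc n} f≤g = +-mono-≤ (f≤g zero) (∑-mono-≤ (f≤g ∘ suc))

term≤∑ : (f : Fin n → ℕ) (i : Fin n) → f i ≤ sum f
term≤∑ f zero    = m≤m+n _ _
term≤∑ f (suc i) = ≤-trans (term≤∑ (f ∘ suc) i) (m≤n+m _ _)

two-terms≤∑ : (f : Fin n → ℕ) {i j : Fin n} → i ≢ j → f i + f j ≤ sum f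
two-terms≤∑ f {zero}  {zero}  i≢j = ⊥-elim (i≢j refl)
two-terms≤∑ f {zero}  {suc j} i≢j = +-monoʳ-≤ (f zero) (term≤∑ (f ∘ suc) j)
two-terms≤∑ f {suc i} {zero}  i≢j =
  ≤-trans (≤-reflexive (+-comm (f (suc i)) (f zero))) (+-monoʳ-≤ (f zero) (term≤∑ (f ∘ suc) i))
two-terms≤∑ f {suc i} {suc j} i≢j =
  ≤-trans (two-terms≤∑ (f ∘ suc) (i≢j ∘ cong suc)) (m≤n+m _ _)

∑≤∣p∣* : (p : Subset n) (f : Fin n → ℕ) (d : ℕ) →
  (∀ {i} → i ∈ p → f i ≤ d) → (∀ {i} → i ∉ p → f i ≡ 0) → sum f ≤ ∣ p ∣ * d
∑≤∣p∣* []            f d ≤d ≡0 = z≤n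
∑≤∣p∣* (inside ∷ p)  f d ≤d ≡0 =
  +-mono-≤ (≤d here) (∑≤∣p∣* p (f ∘ suc) d (≤d ∘ there) (λ i∉p → ≡0 (i∉p ∘ drop-there)))
∑≤∣p∣* (outside ∷ p) f d ≤d ≡0 =
  subst (_≤ ∣ p ∣ * d) (cong (_+ sum (f ∘ suc)) (sym (≡0 {zero} λ ())))
    (∑≤∣p∣* p (f ∘ suc) d (≤d ∘ there) (λ i∉p → ≡0 (i∉p ∘ drop-there)))

count : {P : Pred (Fin n) 0ℓ} → Decidable P → ℕ
count {n} P? = ∑[ i < n ] 𝟙 (P? i)

∣p∣≡count : (p : Subset n) → ∣ p ∣ ≡ count (_∈? p)
∣p∣≡count []            = refl
∣p∣≡count (inside ∷ p)  = cong suc (∣p∣≡count p)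
∣p∣≡count (outside ∷ p) = ∣p∣≡count p

count-≟ : (a : Fin n) → count (a ≟_) ≡ 1
count-≟ {suc n} zero    = cong suc (sum-replicate-zero n)
count-≟ {suc n} (suc a) = count-≟ a

count-disjoint-≤ : {P Q R : Pred (Fin n) 0ℓ} (P? : Decidable P) (Q? : Decidable Q) (R? : Decidable R) →
  (∀ {i} → P i → R i) → (∀ {i} → Q i → R i) → (∀ {i} → P i → ¬ Q i) →
  count P? + count Q? ≤ count R?
count-disjoint-≤ {n} P? Q? R? P⇒R Q⇒R P⇒¬Q = begin
  count P? + count Q?               ≡⟨ ∑-distrib-+ (𝟙 ∘ P?) (𝟙 ∘ Q?) ⟨
  ∑[ i < n ] (𝟙 (P? i) + 𝟙 (Q? i))  ≤⟨ ∑-mono-≤ (λ i → 𝟙-disjoint (P? i) (Q? i) (R? i) P⇒R Q⇒R P⇒¬Q) ⟩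
  count R?                          ∎
  where open ≤-Reasoning

∈-tabulate⁺ : {P : Pred (Fin n) 0ℓ} (P? : Decidable P) {x : Fin n} →
  P x → x ∈ tabulate (λ z → ⌊ P? z ⌋)
∈-tabulate⁺ P? {x} px with P? x | lookup∘tabulate (λ z → ⌊ P? z ⌋) x
... | yes _  | lookup≡true = lookup⇒[]= x _ lookup≡true
... | no ¬px | _       = ⊥-elim (¬px px)

∈-tabulate⁻ : {P : Pred (Fin n) 0ℓ} (P? : Decidable P) {x : Fin n} →
  x ∈ tabulate (λ z → ⌊ P? z ⌋) → P x
∈-tabulate⁻ P? {x} x∈ with P? x | trans (sym (lookup∘tabulate (λ z → ⌊ P? z ⌋) x)) ([]=⇒lookup x∈)
... | yes px | _  = px
... | no _   | ()

x∈p─q⇒x∉q : (p q : Subset n) {x : Fin n} → x ∈ p ─ q → x ∉ q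
x∈p─q⇒x∉q (inside ∷ p)  (outside ∷ q) here       = λ ()
x∈p─q⇒x∉q (outside ∷ p) (outside ∷ q) {zero} ()
x∈p─q⇒x∉q (_ ∷ p)       (inside ∷ q)  {zero} ()
x∈p─q⇒x∉q (_ ∷ p)       (_ ∷ q)       (there x∈) = λ { (there x∈q) → x∈p─q⇒x∉q p q x∈ x∈q }

x∈p∪⁅y⁆⁻ : (p : Subset n) (y : Fin n) {x : Fin n} → x ∈ p ∪ ⁅ y ⁆ → x ∈ p ⊎ x ≡ y
x∈p∪⁅y⁆⁻ p y x∈ = Sum.map₂ (x∈⁅y⁆⇒x≡y y) (x∈p∪q⁻ p ⁅ y ⁆ x∈)

⊕-comm : (x y : Fin n) → x ⊕ y ≡ y ⊕ x
⊕-comm {suc m} x y = cong (_mod suc m) (+-comm (toℕ x) (toℕ y))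

hatSum? : (A : Subset n) (z : Fin n) →
  Dec (∃₂ λ x₁ x₂ → x₁ ∈ A × x₂ ∈ A × x₁ ≢ x₂ × x₁ ⊕ x₂ ≡ z)
hatSum? A z = any? λ x₁ → any? λ x₂ →
  (x₁ ∈? A) ×-dec ((x₂ ∈? A) ×-dec (¬? (x₁ ≟ x₂) ×-dec ((x₁ ⊕ x₂) ≟ z)))

∈-hatSum⁺ : {A : Subset n} {x₁ x₂ : Fin n} → x₁ ∈ A → x₂ ∈ A → x₁ ≢ x₂ → x₁ ⊕ x₂ ∈ hatSum A
∈-hatSum⁺ {A = A} x₁∈A x₂∈A x₁≢x₂ = ∈-tabulate⁺ (hatSum? A) (_ , _ , x₁∈A , x₂∈A , x₁≢x₂ , refl)

∈-hatSum⁻ : {A : Subset n} {z : Fin n} → z ∈ hatSum A →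
  ∃₂ λ x₁ x₂ → x₁ ∈ A × x₂ ∈ A × x₁ ≢ x₂ × x₁ ⊕ x₂ ≡ z
∈-hatSum⁻ {A = A} = ∈-tabulate⁻ (hatSum? A)

∈-translate⁺ : {A : Subset n} (y : Fin n) {y' : Fin n} → y' ∈ A → y ⊕ y' ∈ translate y A
∈-translate⁺ {A = A} y y'∈A =
  ∈-tabulate⁺ (λ z → any? λ y' → (y' ∈? A) ×-dec ((y ⊕ y') ≟ z)) (_ , y'∈A , refl)

Adjacent : (H Y : Subset n) → Fin n → Fin n → Set
Adjacent H Y y y' = y ∈ Y × y' ∈ Y × y ≢ y' × y ⊕ y' ∈ H

adjacent? : (H Y : Subset n) (y y' : Fin n) → Dec (Adjacent H Y y y')
adjacent? H Y y y' = (y ∈? Y) ×-dec ((y' ∈? Y) ×-dec (¬? (y ≟ y') ×-dec ((y ⊕ y') ∈? H)))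

degree : (H Y : Subset n) → Fin n → ℕ
degree H Y y = count (adjacent? H Y y)

degree-∉ : (H Y : Subset n) {y : Fin n} → y ∉ Y → degree H Y y ≡ 0
degree-∉ {n} H Y y∉Y =
  trans (sum-cong-≗ (λ y' → 𝟙-no (adjacent? H Y _ y') (y∉Y ∘ proj₁))) (sum-replicate-zero n)

∣Y'∣+degree≤∣Y∣ : (H : Subset n) {Y Y' : Subset n} {y : Fin n} →
  Y' ⊆ Y → Empty (H ∩ hatSum Y') → y ∈ Y' → ∣ Y' ∣ + degree H Y y ≤ ∣ Y ∣
∣Y'∣+degree≤∣Y∣ H {Y} {Y'} {y} Y'⊆Y H∩Y'+̂Y'=∅ y∈Y' = begin
  ∣ Y' ∣ + degree H Y y          ≡⟨ cong (_+ degree H Y y) (∣p∣≡count Y') ⟩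
  count (_∈? Y') + degree H Y y  ≤⟨ count-disjoint-≤ (_∈? Y') (adjacent? H Y y) (_∈? Y)
                                      Y'⊆Y (proj₁ ∘ proj₂) non-adjacent ⟩
  count (_∈? Y)                  ≡⟨ ∣p∣≡count Y ⟨
  ∣ Y ∣                          ∎
  where
  open ≤-Reasoning
  non-adjacent : ∀ {y'} → y' ∈ Y' → ¬ Adjacent H Y y y'
  non-adjacent y'∈Y' (_ , _ , y≢y' , y+y'∈H) =
    H∩Y'+̂Y'=∅ (_ , x∈p∩q⁺ (y+y'∈H , ∈-hatSum⁺ y∈Y' y'∈Y' y≢y'))

module _ (H Y : Subset n) where

  private
    edge-with-sum : Fin n → Fin n → Fin n → ℕ
    edge-with-sum s y y' = 𝟙 (adjacent? H Y y y' ×-dec (y ⊕ y' ≟ s))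

    edges-with-sum : Fin n → ℕ
    edges-with-sum s = ∑[ y < n ] ∑[ y' < n ] edge-with-sum s y y'

    ∑-edge-with-sum : (y y' : Fin n) → ∑[ s < n ] edge-with-sum s y y' ≡ 𝟙 (adjacent? H Y y y')
    ∑-edge-with-sum y y' = begin
      ∑[ s < n ] 𝟙 (adj ×-dec (y ⊕ y' ≟ s))  ≡⟨ sum-cong-≗ (λ s → 𝟙-×-dec adj (y ⊕ y' ≟ s)) ⟩
      ∑[ s < n ] (𝟙 adj * 𝟙 (y ⊕ y' ≟ s))   ≡⟨ *-distribˡ-sum (𝟙 adj) (λ s → 𝟙 (y ⊕ y' ≟ s)) ⟨
      𝟙 adj * count (y ⊕ y' ≟_)              ≡⟨ cong (𝟙 adj *_) (count-≟ (y ⊕ y')) ⟩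
      𝟙 adj * 1                              ≡⟨ *-identityʳ (𝟙 adj) ⟩
      𝟙 adj                                  ∎
      where
      open ≡-Reasoning
      adj = adjacent? H Y y y'

    -- The factor 2: the edges y₁ ~ y₂ and y₂ ~ y₁ both have sum s.
    edges-with-sum-∈ : (s : Fin n) → 2 * 𝟙 (s ∈? H ∩ hatSum Y) ≤ edges-with-sum s
    edges-with-sum-∈ s with s ∈? H ∩ hatSum Y
    ... | no _    = z≤n
    ... | yes s∈S with x∈p∩q⁻ H (hatSum Y) s∈S
    ... | s∈H , s∈Y+̂Y with ∈-hatSum⁻ s∈Y+̂Y
    ... | y₁ , y₂ , y₁∈Y , y₂∈Y , y₁≢y₂ , refl = begin
      2                                                    ≡⟨ cong₂ _+_ edge₁₂ edge₂₁ ⟨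
      edge-with-sum s y₁ y₂ + edge-with-sum s y₂ y₁        ≤⟨ +-mono-≤ (term≤∑ (row y₁) y₂) (term≤∑ (row y₂) y₁) ⟩
      sum (row y₁) + sum (row y₂)                          ≤⟨ two-terms≤∑ (sum ∘ row) y₁≢y₂ ⟩
      edges-with-sum s                                     ∎
      where
      open ≤-Reasoning
      row : Fin n → Fin n → ℕ
      row = edge-with-sum s
      edge₁₂ : edge-with-sum s y₁ y₂ ≡ 1
      edge₁₂ = 𝟙-yes (adjacent? H Y y₁ y₂ ×-dec (y₁ ⊕ y₂ ≟ y₁ ⊕ y₂)) ((y₁∈Y , y₂∈Y , y₁≢y₂ , s∈H) , refl)
      edge₂₁ : edge-with-sum s y₂ y₁ ≡ 1
      edge₂₁ = 𝟙-yes (adjacent? H Y y₂ y₁ ×-dec (y₂ ⊕ y₁ ≟ y₁ ⊕ y₂))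
        ((y₂∈Y , y₁∈Y , y₁≢y₂ ∘ sym , subst (_∈ H) (⊕-comm y₁ y₂) s∈H) , ⊕-comm y₂ y₁)

  2∣H∩Y+̂Y∣≤∑degree : 2 * ∣ H ∩ hatSum Y ∣ ≤ ∑[ y < n ] degree H Y y
  2∣H∩Y+̂Y∣≤∑degree = begin
    2 * ∣ S ∣                                              ≡⟨ cong (2 *_) (∣p∣≡count S) ⟩
    2 * count (_∈? S)                                      ≡⟨ *-distribˡ-sum 2 (λ s → 𝟙 (s ∈? S)) ⟩
    ∑[ s < n ] (2 * 𝟙 (s ∈? S))                            ≤⟨ ∑-mono-≤ edges-with-sum-∈ ⟩
    ∑[ s < n ] ∑[ y < n ] ∑[ y' < n ] edge-with-sum s y y' ≡⟨ ∑-comm (λ s y → ∑[ y' < n ] edge-with-sum s y y') ⟩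
    ∑[ y < n ] ∑[ s < n ] ∑[ y' < n ] edge-with-sum s y y' ≡⟨ sum-cong-≗ (λ y → ∑-comm (λ s y' → edge-with-sum s y y')) ⟩
    ∑[ y < n ] ∑[ y' < n ] ∑[ s < n ] edge-with-sum s y y' ≡⟨ sum-cong-≗ (λ y → sum-cong-≗ (∑-edge-with-sum y)) ⟩
    ∑[ y < n ] degree H Y y                                ∎
    where
    open ≤-Reasoning
    S = H ∩ hatSum Y

module _ (X Y : Subset n) where

  InI-⁅⁆ : {y : Fin n} → y ∈ Y → InI X Y ⁅ y ⁆
  InI-⁅⁆ {y} y∈Y = ⁅y⁆⊆Y , independent
    where
    ⁅y⁆⊆Y : ⁅ y ⁆ ⊆ Y
    ⁅y⁆⊆Y x∈⁅y⁆ = subst (_∈ Y) (sym (x∈⁅y⁆⇒x≡y y x∈⁅y⁆)) y∈Y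
    independent : Empty (hatSum X ∩ hatSum ⁅ y ⁆)
    independent (_ , s∈) with ∈-hatSum⁻ (proj₂ (x∈p∩q⁻ (hatSum X) _ s∈))
    ... | _ , _ , x₁∈⁅y⁆ , x₂∈⁅y⁆ , x₁≢x₂ , _ =
      x₁≢x₂ (trans (x∈⁅y⁆⇒x≡y y x₁∈⁅y⁆) (sym (x∈⁅y⁆⇒x≡y y x₂∈⁅y⁆)))

  InI-∪⁅⁆ : {A : Subset n} {z : Fin n} → InI X Y A → z ∈ Y →
    Empty (translate z A ∩ hatSum X) → InI X Y (A ∪ ⁅ z ⁆)
  InI-∪⁅⁆ {A} {z} (A⊆Y , X̂∩Â=∅) z∈Y z+A∩X̂=∅ = A∪⁅z⁆⊆Y , independent
    where
    A∪⁅z⁆⊆Y : A ∪ ⁅ z ⁆ ⊆ Y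
    A∪⁅z⁆⊆Y x∈ with x∈p∪⁅y⁆⁻ A z x∈
    ... | inj₁ x∈A = A⊆Y x∈A
    ... | inj₂ refl = z∈Y
    independent : Empty (hatSum X ∩ hatSum (A ∪ ⁅ z ⁆))
    independent (_ , s∈) with x∈p∩q⁻ (hatSum X) _ s∈
    ... | s∈X̂ , s∈Â with ∈-hatSum⁻ s∈Â
    ... | x₁ , x₂ , x₁∈ , x₂∈ , x₁≢x₂ , refl with x∈p∪⁅y⁆⁻ A z x₁∈ | x∈p∪⁅y⁆⁻ A z x₂∈
    ... | inj₁ x₁∈A | inj₁ x₂∈A = X̂∩Â=∅ (_ , x∈p∩q⁺ (s∈X̂ , ∈-hatSum⁺ x₁∈A x₂∈A x₁≢x₂))
    ... | inj₁ x₁∈A | inj₂ refl =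
      z+A∩X̂=∅ (_ , x∈p∩q⁺ (∈-translate⁺ z x₁∈A , subst (_∈ hatSum X) (⊕-comm x₁ z) s∈X̂))
    ... | inj₂ refl | inj₁ x₂∈A = z+A∩X̂=∅ (_ , x∈p∩q⁺ (∈-translate⁺ z x₂∈A , s∈X̂))
    ... | inj₂ refl | inj₂ refl = x₁≢x₂ refl

  -- Add admissible elements one at a time (each step is a proper superset, so
  -- this terminates); a member of 𝓘 that admits no further element is in 𝓘*.
  InI⇒⊆InIStar : {A : Subset n} → InI X Y A → ∃ λ B → InIStar X Y B × A ⊆ B
  InI⇒⊆InIStar {A} = extend A (⊃-wellFounded A)
    where
    extend : ∀ A → Acc _⊃_ A → InI X Y A → ∃ λ B → InIStar X Y B × A ⊆ B
    extend A (acc larger) A∈𝓘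
      with any? (λ z → (z ∈? Y ─ A) ×-dec ¬? (nonempty? (translate z A ∩ hatSum X)))
    ... | no maximal = A , (A∈𝓘 , λ z z∈Y─A z+A∩X̂=∅ → maximal (z , z∈Y─A , z+A∩X̂=∅)) , λ x∈A → x∈A
    ... | yes (z , z∈Y─A , z+A∩X̂=∅)
      with extend (A ∪ ⁅ z ⁆) (larger A⊂A∪⁅z⁆) (InI-∪⁅⁆ A∈𝓘 (p─q⊆p Y A z∈Y─A) z+A∩X̂=∅)
      where
      A⊂A∪⁅z⁆ : A ⊂ A ∪ ⁅ z ⁆
      A⊂A∪⁅z⁆ = p⊆p∪q ⁅ z ⁆ , z , x∈p∪q⁺ (inj₂ (x∈⁅x⁆ z)) , x∈p─q⇒x∉q Y A z∈Y─A
    ... | B , B∈𝓘* , A∪⁅z⁆⊆B = B , B∈𝓘* , λ x∈A → A∪⁅z⁆⊆B (p⊆p∪q ⁅ z ⁆ x∈A)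

  degree≤k∸t : {k t : ℕ} → ∣ Y ∣ ≡ k → IsMinIStarSize X Y t →
    {y : Fin n} → y ∈ Y → degree (hatSum X) Y y ≤ k ∸ t
  degree≤k∸t {k} {t} ∣Y∣≡k (_ , t≤∣𝓘*∣) {y} y∈Y
    with InI⇒⊆InIStar (InI-⁅⁆ y∈Y)
  ... | Y' , Y'∈𝓘*@((Y'⊆Y , X̂∩Ŷ'=∅) , _) , ⁅y⁆⊆Y' = begin
    degree (hatSum X) Y y  ≤⟨ m+n≤o⇒m≤o∸n _ (subst (_≤ k) (+-comm ∣ Y' ∣ _) ∣Y'∣+degree≤k) ⟩
    k ∸ ∣ Y' ∣             ≤⟨ ∸-monoʳ-≤ k (t≤∣𝓘*∣ Y' Y'∈𝓘*) ⟩
    k ∸ t                  ∎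
    where
    open ≤-Reasoning
    ∣Y'∣+degree≤k : ∣ Y' ∣ + degree (hatSum X) Y y ≤ k
    ∣Y'∣+degree≤k = subst (_ ≤_) ∣Y∣≡k
      (∣Y'∣+degree≤∣Y∣ (hatSum X) Y'⊆Y X̂∩Ŷ'=∅ (⁅y⁆⊆Y' (x∈⁅x⁆ y)))

lemma9p4 : (n : ℕ) → Prime n → (k : ℕ) → (X Y : Subset n) →
    ∣ X ∣ ≡ k → ∣ Y ∣ ≡ k →
    ∣ hatSum X ∣ ≡ k C 2 → ∣ hatSum Y ∣ ≡ k C 2 →
    ¬ (Y ≡ X) → ¬ Empty (hatSum X ∩ hatSum Y) →
    (t : ℕ) → IsMinIStarSize X Y t →
    2 * ∣ hatSum X ∩ hatSum Y ∣ ≤ k * (k ∸ t)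
lemma9p4 n _ k X Y _ ∣Y∣≡k _ _ _ _ t t-min = begin
  2 * ∣ hatSum X ∩ hatSum Y ∣          ≤⟨ 2∣H∩Y+̂Y∣≤∑degree (hatSum X) Y ⟩
  ∑[ y < n ] degree (hatSum X) Y y     ≤⟨ ∑≤∣p∣* Y _ (k ∸ t) (degree≤k∸t X Y ∣Y∣≡k t-min) (degree-∉ (hatSum X) Y) ⟩
  ∣ Y ∣ * (k ∸ t)                      ≡⟨ cong (_* (k ∸ t)) ∣Y∣≡k ⟩
  k * (k ∸ t)                          ∎
  where open ≤-Reasoning
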